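{- Let $G$ be a graph and let $G'$ be its complement. Let $H$ be the graph obtained from $G'$ by adding a set $X$ of four new pairwise non-adjacent vertices and making each vertex of $X$ adjacent to every vertex of $G'$. Then $G$ is 3-colourable if and only if $\mathrm{tcl}(H)\le 3$.
   Context: All graphs are finite, simple and undirected. For a graph $G$ and $X\subseteq V(G)$, let $\mathrm{vcc}(X)$ be the minimum number of cliques of $G$ whose union is $X$. A tree decomposition of $G$ is a pair $(T,\{X_t\}_{t\in V(T)})$ with $T$ a tree and bags $X_t\subseteq V(G)$ such that every vertex lies in some bag, both endpoints of every edge lie in a common bag, and for every vertex $v$ the nodes $t$ with $v\in X_t$ induce a connected subtree of $T$. An augmented tree decomposition is a tree decomposition together with, for each node $t$, a collection $C_t$ of cliques of $G$ whose union is $X_t$; its width is $\max_t |C_t|$. The tree-clique width $\mathrm{tcl}(G)$ is the minimum width of an augmented tree decomposition of $G$, i.e. the minimum over tree decompositions of $\max_t \mathrm{vcc}(X_t)$. -}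

module Defs where

open import Data.Nat using (ℕ; _+_; _≤_)
open import Data.Fin using (Fin; splitAt; _≟_)
open import Data.Fin.Subset using (Subset; _∈_)
open import Data.Bool using (Bool; true; false; not; _∧_)
open import Data.Bool.Properties using (∧-comm)
open import Data.Sum using (_⊎_; inj₁; inj₂)
open import Data.Product using (Σ; ∃; ∃-syntax; _×_; _,_)
open import Data.List using (List; []; _∷_; _++_; [_]; length)
open import Data.List.Relation.Unary.All using (All)
open import Data.List.Relation.Unary.Any using (Any)
open import Data.List.Relation.Unary.Linked using (Linked)
open import Data.List.Relation.Unary.Unique.Propositional using (Unique)
open import Relation.Nullary using (¬_; yes; no)
open import Relation.Nullary.Decidable using (⌊_⌋)
open import Relation.Binary.PropositionalEquality using (_≡_; _≢_; refl; sym; cong)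
open import Function.Bundles using (_⇔_)

record Graph (n : ℕ) : Set where
  field
    adj    : Fin n → Fin n → Bool
    adj-sym    : ∀ u v → adj u v ≡ adj v u
    adj-irrefl : ∀ v → adj v v ≡ false
open Graph public

Adj : ∀ {n} → Graph n → Fin n → Fin n → Set
Adj G u v = adj G u v ≡ true

private
  eqb : ∀ {n} → Fin n → Fin n → Bool
  eqb u v = ⌊ u ≟ v ⌋

  eqb-sym : ∀ {n} (u v : Fin n) → eqb u v ≡ eqb v u
  eqb-sym u v with u ≟ v | v ≟ u
  ... | yes _ | yes _ = refl
  ... | yes p | no q = Data.Empty.⊥-elim (q (sym p))
    where import Data.Empty
  ... | no q | yes p = Data.Empty.⊥-elim (q (sym p))
    where import Data.Empty
  ... | no _ | no _ = refl

  eqb-refl : ∀ {n} (v : Fin n) → eqb v v ≡ true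
  eqb-refl v with v ≟ v
  ... | yes _ = refl
  ... | no q = Data.Empty.⊥-elim (q refl)
    where import Data.Empty

  x∧not-true : ∀ (b : Bool) → b ∧ not true ≡ false
  x∧not-true true = refl
  x∧not-true false = refl

complement : ∀ {n} → Graph n → Graph n
complement G = record
  { adj = λ u v → not (adj G u v) ∧ not (eqb u v)
  ; adj-sym = λ u v → Relation.Binary.PropositionalEquality.cong₂ (λ a b → not a ∧ not b)
                        (adj-sym G u v) (eqb-sym u v)
  ; adj-irrefl = λ v → Relation.Binary.PropositionalEquality.subst
                        (λ b → not (adj G v v) ∧ not b ≡ false) (sym (eqb-refl v))
                        (x∧not-true (not (adj G v v)))
  }
  where import Relation.Binary.PropositionalEquality

-- Adding a set of k new pairwise non-adjacent vertices (the vertices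
-- n, ..., n+k-1 of Fin (n + k)), each adjacent to every old vertex.

private
  joinAdj : ∀ {n} k → Graph n → Fin (n + k) → Fin (n + k) → Bool
  joinAdj {n} k G u v with splitAt n u | splitAt n v
  ... | inj₁ a | inj₁ b = adj G a b
  ... | inj₁ _ | inj₂ _ = true
  ... | inj₂ _ | inj₁ _ = true
  ... | inj₂ _ | inj₂ _ = false

  joinAdj-sym : ∀ {n} k (G : Graph n) u v → joinAdj k G u v ≡ joinAdj k G v u
  joinAdj-sym {n} k G u v with splitAt n u | splitAt n v
  ... | inj₁ a | inj₁ b = adj-sym G a b
  ... | inj₁ _ | inj₂ _ = refl
  ... | inj₂ _ | inj₁ _ = refl
  ... | inj₂ _ | inj₂ _ = refl

  joinAdj-irrefl : ∀ {n} k (G : Graph n) v → joinAdj k G v v ≡ false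
  joinAdj-irrefl {n} k G v with splitAt n v
  ... | inj₁ a = adj-irrefl G a
  ... | inj₂ _ = refl

addUniversalIndependent : ∀ {n} (k : ℕ) → Graph n → Graph (n + k)
addUniversalIndependent k G = record
  { adj = joinAdj k G
  ; adj-sym = joinAdj-sym k G
  ; adj-irrefl = joinAdj-irrefl k G
  }

Colourable : ∀ {n} → ℕ → Graph n → Set
Colourable {n} k G = Σ (Fin n → Fin k) λ c → ∀ u v → Adj G u v → c u ≢ c v

data WalkIn {n} (G : Graph n) (P : Fin n → Set) : Fin n → Fin n → Set where
  here : ∀ {v} → P v → WalkIn G P v v
  step : ∀ {u w v} → P u → Adj G u w → WalkIn G P w v → WalkIn G P u v

Connected : ∀ {n} → Graph n → Set
Connected {n} G = ∀ (u v : Fin n) → WalkIn G (λ _ → Data.Unit.⊤) u v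
  where import Data.Unit

-- a cycle: distinct vertices x, y₁, …, yⱼ, y (j ≥ 1, so at least 3
-- vertices) with consecutive ones adjacent and y adjacent to x
HasCycle : ∀ {n} → Graph n → Set
HasCycle {n} G =
  Σ (Fin n) λ x → Σ (List (Fin n)) λ ys → Σ (Fin n) λ y →
    1 ≤ length ys ×
    Unique (x ∷ ys ++ [ y ]) ×
    Linked (Adj G) (x ∷ ys ++ [ y ]) ×
    Adj G y x

IsTree : ∀ {m} → Graph m → Set
IsTree T = Connected T × ¬ HasCycle T

IsClique : ∀ {n} → Graph n → Subset n → Set
IsClique G K = ∀ u v → u ∈ K → v ∈ K → u ≢ v → Adj G u v

VccAtMost : ∀ {n} → Graph n → ℕ → Subset n → Set
VccAtMost {n} G k X =
  Σ (List (Subset n)) λ Cs →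
    length Cs ≤ k × All (IsClique G) Cs × (∀ v → (v ∈ X) ⇔ Any (v ∈_) Cs)

record TreeDecomposition {n} (G : Graph n) : Set₁ where
  field
    m       : ℕ
    tree    : Graph m
    isTree  : IsTree tree
    bag     : Fin m → Subset n
    covers  : ∀ v → ∃[ t ] (v ∈ bag t)
    edges   : ∀ u v → Adj G u v → ∃[ t ] (u ∈ bag t × v ∈ bag t)
    subtree : ∀ v s t → v ∈ bag s → v ∈ bag t → WalkIn tree (λ r → v ∈ bag r) s t
open TreeDecomposition public

TclAtMost : ∀ {n} → Graph n → ℕ → Set₁
TclAtMost G k = Σ (TreeDecomposition G) λ D → ∀ t → VccAtMost G k (bag D t)

-- A 3-colouring of G splits V(G) into three cliques of G′. Over the tree with two nodes,
-- put all of V(G) and two of the four new vertices in each bag; there the two new vertices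
-- join two of the colour classes, so three cliques cover each bag.
-- Conversely, since every old vertex is adjacent to every new one, some bag contains all old
-- or all new vertices: otherwise walk from bag to bag, always towards a bag holding an old and
-- a new vertex both missing from the current one; in a tree this walk never turns back, so it
-- cannot go on forever. Four pairwise non-adjacent new vertices need four cliques, and three
-- cliques of G′ covering V(G) are the colour classes of a 3-colouring of G.
module Submission where

open import Defs
open import Data.Nat using (ℕ; zero; suc; _+_; _≤_; z≤n; s≤s)
open import Data.Nat.Properties using (≤-trans; ≤-reflexive; m≤m+n; +-suc; 1+n≰n)
open import Data.Fin using (Fin; zero; suc; splitAt; _↑ˡ_; _↑ʳ_; remQuot; combine; inject₁; inject≤)
  renaming (_≟_ to _≟ᶠ_)
open import Data.Fin.Properties
  using ( injective⇒≤; <⇒notInjective; all?; ¬∀⟶∃¬; inject≤-injective; inject₁-injective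
        ; ↑ˡ-injective; ↑ʳ-injective; splitAt-↑ˡ; splitAt-↑ʳ; splitAt⁻¹-↑ˡ; splitAt⁻¹-↑ʳ; combine-remQuot)
open import Data.Fin.Subset using (Subset; _∈_)
open import Data.Fin.Subset.Properties using (_∈?_)
open import Data.Vec using (tabulate)
open import Data.Vec.Properties using (lookup∘tabulate; []=⇒lookup; lookup⇒[]=)
open import Data.Bool using (Bool; true; false)
open import Data.Bool.Properties using (T-≡; ¬-not)
open import Data.Product using (Σ; ∃-syntax; _×_; _,_; proj₁; proj₂; uncurry)
open import Data.Sum using (_⊎_; inj₁; inj₂)
open import Data.Unit using (⊤; tt)
open import Data.Empty using (⊥; ⊥-elim)
import Data.List as List
open import Data.List using (List; []; _∷_; _++_; [_]; length; lookup)
open import Data.List.Properties using (length-++-≤ʳ; length-tabulate)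
import Data.List.Relation.Unary.All as All
open import Data.List.Relation.Unary.All using (All; []; _∷_)
import Data.List.Relation.Unary.All.Properties as All
import Data.List.Relation.Unary.Any as Any
import Data.List.Relation.Unary.Any.Properties as Any
open import Data.List.Relation.Unary.Linked using (Linked; [-]; _∷_)
open import Data.List.Relation.Unary.Unique.Propositional using (Unique)
open import Data.List.Relation.Unary.AllPairs using ([]; _∷_)
open import Data.List.Membership.Propositional.Properties using (∈-lookup)
import Data.List.Membership.DecPropositional as DecMembership
open import Relation.Nullary using (¬_; Dec; yes; no)
open import Relation.Nullary.Decidable using (⌊_⌋; toWitness; fromWitness; _×-dec_)
open import Relation.Unary using (Decidable)
open import Relation.Binary.PropositionalEquality
  using (_≡_; _≢_; refl; sym; trans; cong; cong₂; subst; module ≡-Reasoning)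
open import Relation.Binary.Construct.Closure.ReflexiveTransitive as Star using (Star; ε; _◅_; _◅◅_)
open import Function.Base using (_∘_)
open import Function.Bundles using (_⇔_; mk⇔; Equivalence)
open import Function.Definitions using (Injective)

open Equivalence

Unique⇒lookup-injective : ∀ {A : Set} {xs : List A} → Unique xs → Injective _≡_ _≡_ (lookup xs)
Unique⇒lookup-injective {xs = _ ∷ _} _ {zero} {zero} _ = refl
Unique⇒lookup-injective {xs = _ ∷ _} (x∉ ∷ _) {zero} {suc j} e = ⊥-elim (All.lookup x∉ (∈-lookup j) e)
Unique⇒lookup-injective {xs = _ ∷ _} (x∉ ∷ _) {suc i} {zero} e = ⊥-elim (All.lookup x∉ (∈-lookup i) (sym e))
Unique⇒lookup-injective {xs = _ ∷ _} (_ ∷ u) {suc i} {suc j} e = cong suc (Unique⇒lookup-injective u e)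

Unique⇒length≤ : ∀ {m} {xs : List (Fin m)} → Unique xs → length xs ≤ m
Unique⇒length≤ u = injective⇒≤ (Unique⇒lookup-injective u)

Adj-sym : ∀ {n} (G : Graph n) {u v} → Adj G u v → Adj G v u
Adj-sym G {u} {v} uv = trans (adj-sym G v u) uv

Adj⇒≢ : ∀ {n} (G : Graph n) {u v} → Adj G u v → u ≢ v
Adj⇒≢ G {u} uu refl with trans (sym (adj-irrefl G u)) uu
... | ()

module _ {n} {G : Graph n} where

  walk-head : ∀ {P u v} → WalkIn G P u v → P u
  walk-head (here p) = p
  walk-head (step p _ _) = p

  walk-last : ∀ {P u v} → WalkIn G P u v → P v
  walk-last (here p) = p
  walk-last (step _ _ w) = walk-last w

  walk-map : ∀ {P Q : Fin n → Set} → (∀ {x} → P x → Q x) → ∀ {u v} → WalkIn G P u v → WalkIn G Q u v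
  walk-map f (here p) = here (f p)
  walk-map f (step p uw w) = step (f p) uw (walk-map f w)

  _++ʷ_ : ∀ {P u v w} → WalkIn G P u v → WalkIn G P v w → WalkIn G P u w
  here _ ++ʷ w′ = w′
  step p uw w ++ʷ w′ = step p uw (w ++ʷ w′)

  avoids-or-reaches : ∀ {P u v} s → WalkIn G P u v → WalkIn G (λ x → P x × x ≢ s) u v ⊎ WalkIn G P u s
  avoids-or-reaches s (here {v} p) with v ≟ᶠ s
  ... | yes refl = inj₂ (here p)
  ... | no v≢s = inj₁ (here (p , v≢s))
  avoids-or-reaches s (step {u} p uw w) with u ≟ᶠ s | avoids-or-reaches s w
  ... | yes refl | _ = inj₂ (here p)
  ... | no u≢s | inj₁ w′ = inj₁ (step (p , u≢s) uw w′)
  ... | no u≢s | inj₂ w′ = inj₂ (step p uw w′)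

  avoids-or-leaves : ∀ {P u v} t → WalkIn G P u v → t ≢ v →
    WalkIn G (_≢ t) u v ⊎ ∃[ s ] (Adj G t s × WalkIn G (_≢ t) s v)
  avoids-or-leaves t (here _) t≢v = inj₁ (here (λ v≡t → t≢v (sym v≡t)))
  avoids-or-leaves t (step {u} {w} _ uw rest) t≢v with avoids-or-leaves t rest t≢v
  ... | inj₂ exit = inj₂ exit
  ... | inj₁ rest′ with u ≟ᶠ t
  ...   | yes refl = inj₂ (w , uw , rest′)
  ...   | no u≢t = inj₁ (step u≢t uw rest′)

  walk⇒star : ∀ {P u v} → WalkIn G P u v → Star (λ a b → Adj G a b × P b) u v
  walk⇒star (here _) = ε
  walk⇒star (step _ uw w) = (uw , walk-head w) ◅ walk⇒star w

module _ {n} {R : Fin n → Fin n → Set} where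

  vertices : ∀ {u v} → Star R u v → List (Fin n)
  vertices {u} ε = [ u ]
  vertices {u} (_ ◅ p) = u ∷ vertices p

  inner-vertices : ∀ {u v} → Star R u v → List (Fin n)
  inner-vertices ε = []
  inner-vertices {u} (_ ◅ p) = u ∷ inner-vertices p

  vertices≡ : ∀ {u v} (p : Star R u v) → vertices p ≡ inner-vertices p ++ [ v ]
  vertices≡ ε = refl
  vertices≡ {u} (_ ◅ p) = cong (u ∷_) (vertices≡ p)

  vertices-linked : ∀ {S : Fin n → Fin n → Set} → (∀ {a b} → R a b → S a b) →
                    ∀ {u v} (p : Star R u v) → Linked S (vertices p)
  vertices-linked f ε = [-]
  vertices-linked f (e ◅ ε) = f e ∷ [-]
  vertices-linked f (e ◅ e′ ◅ p) = f e ∷ vertices-linked f (e′ ◅ p)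

  Path : Fin n → Fin n → Set
  Path u v = Σ (Star R u v) (Unique ∘ vertices)

  open DecMembership (_≟ᶠ_ {n}) using () renaming (_∈_ to _∈ₗ_; _∈?_ to _∈ₗ?_)

  suffix-path : ∀ {u v} x (p : Star R u v) → Unique (vertices p) → x ∈ₗ vertices p → Path x v
  suffix-path x ε u (Any.here refl) = ε , u
  suffix-path x (e ◅ p) u (Any.here refl) = e ◅ p , u
  suffix-path x (_ ◅ p) (_ ∷ u) (Any.there x∈p) = suffix-path x p u x∈p

  loop-erase : ∀ {u v} → Star R u v → Path u v
  loop-erase ε = ε , [] ∷ []
  loop-erase {u} (e ◅ p) with loop-erase p
  ... | q , unique-q with u ∈ₗ? vertices q
  ...   | yes u∈q = suffix-path u q unique-q u∈q
  ...   | no u∉q = e ◅ q , All.¬Any⇒All¬ (vertices q) u∉q ∷ unique-q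

HasCycle⇒3≤ : ∀ {n} {G : Graph n} → HasCycle G → 3 ≤ n
HasCycle⇒3≤ (_ , _ ∷ ys , z , _ , unique , _) =
  ≤-trans (s≤s (s≤s (length-++-≤ʳ [ z ] {ys}))) (Unique⇒length≤ unique)

module Acyclic {m} (T : Graph m) (acyclic : ¬ HasCycle T) where

  private
    EdgeOtherThan : Fin m → Fin m → Fin m → Fin m → Set
    EdgeOtherThan t s a b = Adj T a b × (a , b) ≢ (t , s)

    path⇒cycle : ∀ {s t} → Adj T s t → Path {R = EdgeOtherThan t s} t s → HasCycle T
    path⇒cycle st (ε , _) = ⊥-elim (Adj⇒≢ T st refl)
    path⇒cycle st ((_ , ts≢ts) ◅ ε , _) = ⊥-elim (ts≢ts refl)
    path⇒cycle {s} {t} st (e ◅ e′ ◅ p , unique) =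
      t , inner-vertices (e′ ◅ p) , s , s≤s z≤n ,
      subst Unique shape unique , subst (Linked (Adj T)) shape (vertices-linked proj₁ (e ◅ e′ ◅ p)) , st
      where shape = cong (t ∷_) (vertices≡ (e′ ◅ p))

  edge-separates : ∀ {s t q} → Adj T s t → WalkIn T (_≢ t) s q → WalkIn T (_≢ s) t q → ⊥
  edge-separates {s} {t} st s⇝q t⇝q =
    acyclic (path⇒cycle st (loop-erase (Star.map forward (walk⇒star t⇝q) ◅◅ Star.reverse backward (walk⇒star s⇝q))))
    where
      forward : ∀ {a b} → Adj T a b × b ≢ s → EdgeOtherThan t s a b
      forward (ab , b≢s) = ab , λ ab≡ts → b≢s (cong proj₂ ab≡ts)
      backward : ∀ {a b} → Adj T a b × b ≢ t → EdgeOtherThan t s b a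
      backward (ab , b≢t) = Adj-sym T ab , λ ba≡ts → b≢t (cong proj₁ ba≡ts)

  side-shift : ∀ {p t s v} → Adj T p t → Adj T t s → s ≢ p →
               WalkIn T (_≢ t) p v → WalkIn T (_≢ s) t v
  side-shift pt ts s≢p p⇝v with avoids-or-reaches _ p⇝v
  ... | inj₁ p⇝v′ = step (Adj⇒≢ T ts) (Adj-sym T pt) (walk-map proj₂ p⇝v′)
  ... | inj₂ p⇝s = ⊥-elim (edge-separates pt p⇝s (step (λ t≡p → Adj⇒≢ T pt (sym t≡p)) ts (here s≢p)))

module _ {N} {H : Graph N} (D : TreeDecomposition H) where

  private
    M = m D
    T = tree D
  open Acyclic T (proj₂ (isTree D))

  Beyond : Fin M → Fin M → Fin N → Set
  Beyond t s x = ¬ x ∈ bag D t × ∃[ r ] (x ∈ bag D r × WalkIn T (_≢ t) s r)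

  walk-avoiding : ∀ {x t a b} → ¬ x ∈ bag D t → WalkIn T (λ r → x ∈ bag D r) a b → WalkIn T (_≢ t) a b
  walk-avoiding {x} x∉t = walk-map λ x∈r r≡t → x∉t (subst (λ r → x ∈ bag D r) r≡t x∈r)

  Beyond-disjoint : ∀ {p t x y q} → Adj T p t → Beyond p t x → Beyond t p y →
                    x ∈ bag D q → y ∈ bag D q → ⊥
  Beyond-disjoint {x = x} {y} {q} pt (x∉p , r , x∈r , t⇝r) (y∉t , r′ , y∈r′ , p⇝r′) x∈q y∈q =
    edge-separates pt (p⇝r′ ++ʷ walk-avoiding y∉t (subtree D y r′ q y∈r′ y∈q))
                      (t⇝r ++ʷ walk-avoiding x∉p (subtree D x r q x∈r x∈q))

  leave-towards : ∀ {x t r} → ¬ x ∈ bag D t → x ∈ bag D r → ∃[ s ] (Adj T t s × WalkIn T (_≢ t) s r)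
  leave-towards {x} {t} {r} x∉t x∈r
    with avoids-or-leaves t (proj₁ (isTree D) t r) (λ t≡r → x∉t (subst (λ r → x ∈ bag D r) (sym t≡r) x∈r))
  ... | inj₁ t⇝r = ⊥-elim (walk-head t⇝r refl)
  ... | inj₂ exit = exit

  module _ {a b} (f : Fin a → Fin N) (g : Fin b → Fin N) (complete : ∀ i j → Adj H (f i) (g j)) where

    InBag : ∀ {k} → (Fin k → Fin N) → Fin M → Set
    InBag h t = ∀ i → h i ∈ bag D t

    data Progress (t : Fin M) : Set where
      f-in-bag : InBag f t → Progress t
      g-in-bag : InBag g t → Progress t
      move : ∀ s i j → Adj T t s → Beyond t s (f i) → Beyond t s (g j) → Progress t

    progress : ∀ t → Progress t
    progress t with all? (λ i → f i ∈? bag D t) | all? (λ j → g j ∈? bag D t)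
    ... | yes f∈t | _ = f-in-bag f∈t
    ... | no _ | yes g∈t = g-in-bag g∈t
    ... | no f⊈t | no g⊈t
      with ¬∀⟶∃¬ a _ (λ i → f i ∈? bag D t) f⊈t | ¬∀⟶∃¬ b _ (λ j → g j ∈? bag D t) g⊈t
    ... | i , fi∉t | j , gj∉t with edges D (f i) (g j) (complete i j)
    ... | r , fi∈r , gj∈r with leave-towards fi∉t fi∈r
    ... | s , ts , s⇝r = move s i j ts (fi∉t , r , fi∈r , s⇝r) (gj∉t , r , gj∈r , s⇝r)

    no-return : ∀ {p t i j} → Adj T p t → Beyond p t (g j) → Beyond t p (f i) → ⊥
    no-return {i = i} {j} pt gj-beyond fi-beyond with edges D (f i) (g j) (complete i j)
    ... | q , fi∈q , gj∈q = Beyond-disjoint pt gj-beyond fi-beyond gj∈q fi∈q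

    SideInBag : Set
    SideInBag = (∃[ t ] InBag f t) ⊎ (∃[ t ] InBag g t)

    -- All visited nodes lie on the p-side of the edge p–t just crossed, so t is new;
    -- running out of fuel would thus give more than M distinct nodes.
    march : ∀ (fuel : ℕ) {p t j} → Adj T p t → Beyond p t (g j) →
            (visited : List (Fin M)) → All (WalkIn T (_≢ t) p) visited → Unique visited →
            M ≤ fuel + length visited → SideInBag
    march fuel {p} {t} pt beyond visited behind unique bound with progress t
    ... | f-in-bag f∈t = inj₁ (t , f∈t)
    ... | g-in-bag g∈t = inj₂ (t , g∈t)
    ... | move s i j ts fi-beyond gj-beyond with s ≟ᶠ p
    ...   | yes refl = ⊥-elim (no-return pt beyond fi-beyond)
    ...   | no s≢p = continue fuel bound
      where
        unique′ : Unique (t ∷ visited)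
        unique′ = All.map (λ p⇝v t≡v → walk-last p⇝v (sym t≡v)) behind ∷ unique
        continue : ∀ fuel → M ≤ fuel + length visited → SideInBag
        continue zero bound′ = ⊥-elim (1+n≰n (≤-trans (Unique⇒length≤ unique′) bound′))
        continue (suc fuel′) bound′ =
          march fuel′ ts gj-beyond (t ∷ visited) (here (Adj⇒≢ T ts) ∷ All.map (side-shift pt ts s≢p) behind)
                unique′ (≤-trans bound′ (≤-reflexive (sym (+-suc fuel′ (length visited)))))

    side-within-bag : Fin M → SideInBag
    side-within-bag t₀ with progress t₀
    ... | f-in-bag f∈t₀ = inj₁ (t₀ , f∈t₀)
    ... | g-in-bag g∈t₀ = inj₂ (t₀ , g∈t₀)
    ... | move _ _ _ t₀s _ gj-beyond = march M t₀s gj-beyond [] [] [] (m≤m+n M 0)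

⟦_⟧ : ∀ {n} {P : Fin n → Set} → Decidable P → Subset n
⟦ P? ⟧ = tabulate (λ x → ⌊ P? x ⌋)

∈⟦⟧⇔ : ∀ {n} {P : Fin n → Set} (P? : Decidable P) {x} → x ∈ ⟦ P? ⟧ ⇔ P x
∈⟦⟧⇔ P? {x} = mk⇔
  (λ x∈ → toWitness (T-≡ .from (trans (sym (lookup∘tabulate _ x)) ([]=⇒lookup x∈))))
  (λ Px → lookup⇒[]= x _ (trans (lookup∘tabulate _ x) (T-≡ .to (fromWitness Px))))

module _ {N} (H : Graph N) where

  cover-labelling : ∀ {c k X} (h : Fin k → Fin N) → (∀ i → h i ∈ X) → VccAtMost H c X →
    ∃[ κ ] (∀ i j → κ i ≡ κ j → h i ≢ h j → Adj H (h i) (h j))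
  cover-labelling {c} h h∈X (Cs , #Cs≤c , cliques , covered) = κ , κ-clique
    where
      member : ∀ i → Any.Any (h i ∈_) Cs
      member i = covered (h i) .to (h∈X i)
      κ : _ → Fin c
      κ i = inject≤ (Any.index (member i)) #Cs≤c
      κ-clique : ∀ i j → κ i ≡ κ j → h i ≢ h j → Adj H (h i) (h j)
      κ-clique i j κi≡κj hi≢hj with inject≤-injective #Cs≤c #Cs≤c _ _ κi≡κj
      ... | same-index =
        All.lookup cliques (∈-lookup (Any.index (member i))) (h i) (h j)
          (Any.lookup-index (member i))
          (subst (λ ix → h j ∈ lookup Cs ix) (sym same-index) (Any.lookup-index (member j)))
          hi≢hj

  vcc-tabulate : ∀ {c X} (K : Fin c → Subset N) → (∀ k → IsClique H (K k)) →
                 (∀ v → v ∈ X ⇔ (∃[ k ] v ∈ K k)) → VccAtMost H c X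
  vcc-tabulate K cliques covered =
    List.tabulate K , ≤-reflexive (length-tabulate K) , All.tabulate⁺ cliques ,
    λ v → mk⇔ (λ v∈X → let k , v∈K = covered v .to v∈X in Any.tabulate⁺ k v∈K)
              (λ v∈⋃K → covered v .from (Any.tabulate⁻ v∈⋃K))

module _ {n} (G : Graph n) where

  complement-adj : ∀ {i j} → Adj G i j → adj (complement G) i j ≡ false
  complement-adj ij rewrite ij = refl

  complement-nonadj : ∀ {i j} → i ≢ j → ¬ Adj G i j → Adj (complement G) i j
  complement-nonadj {i} {j} i≢j ¬ij rewrite ¬-not ¬ij with i ≟ᶠ j
  ... | no _ = refl
  ... | yes i≡j = ⊥-elim (i≢j i≡j)

module _ {n} (k : ℕ) (G : Graph n) where
  private H = addUniversalIndependent k G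

  universal-old-old : ∀ i i′ → adj H (i ↑ˡ k) (i′ ↑ˡ k) ≡ adj G i i′
  universal-old-old i i′ rewrite splitAt-↑ˡ n i k | splitAt-↑ˡ n i′ k = refl

  universal-old-new : ∀ i j → Adj H (i ↑ˡ k) (n ↑ʳ j)
  universal-old-new i j rewrite splitAt-↑ˡ n i k | splitAt-↑ʳ n k j = refl

  universal-new-new : ∀ j j′ → ¬ Adj H (n ↑ʳ j) (n ↑ʳ j′)
  universal-new-new j j′ rewrite splitAt-↑ʳ n k j | splitAt-↑ʳ n k j′ = λ ()

K₂ : Graph 2
K₂ = record { adj = adj₂ ; adj-sym = sym₂ ; adj-irrefl = irrefl₂ }
  where
    adj₂ : Fin 2 → Fin 2 → Bool
    adj₂ zero (suc zero) = true
    adj₂ (suc zero) zero = true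
    adj₂ _ _ = false
    sym₂ : ∀ u v → adj₂ u v ≡ adj₂ v u
    sym₂ zero zero = refl
    sym₂ zero (suc zero) = refl
    sym₂ (suc zero) zero = refl
    sym₂ (suc zero) (suc zero) = refl
    irrefl₂ : ∀ v → adj₂ v v ≡ false
    irrefl₂ zero = refl
    irrefl₂ (suc zero) = refl

K₂-walk : ∀ {P : Fin 2 → Set} s t → P s → P t → WalkIn K₂ P s t
K₂-walk zero zero Ps _ = here Ps
K₂-walk zero (suc zero) Ps Pt = step Ps refl (here Pt)
K₂-walk (suc zero) zero Ps Pt = step Ps refl (here Pt)
K₂-walk (suc zero) (suc zero) Ps _ = here Ps

K₂-isTree : IsTree K₂
K₂-isTree = (λ s t → K₂-walk s t tt tt) , λ cycle → 3≰2 (HasCycle⇒3≤ {G = K₂} cycle)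
  where
    3≰2 : ¬ 3 ≤ 2
    3≰2 (s≤s (s≤s ()))

module FromColouring {n} (G : Graph n) (c : Fin n → Fin 3) (proper : ∀ u v → Adj G u v → c u ≢ c v) where

  private H = addUniversalIndependent 4 (complement G)

  -- new vertex j sits in the bag of node j and joins the colour class slot j there
  node slot : Fin 4 → Fin 2
  node j = proj₁ (remQuot {2} 2 j)
  slot j = proj₂ (remQuot {2} 2 j)

  node-slot-injective : ∀ {j j′} → node j ≡ node j′ → slot j ≡ slot j′ → j ≡ j′
  node-slot-injective {j} {j′} same-node same-slot = begin
    j                                     ≡⟨ combine-remQuot {2} 2 j ⟨
    uncurry combine (remQuot {2} 2 j)     ≡⟨ cong₂ combine same-node same-slot ⟩
    uncurry combine (remQuot {2} 2 j′)    ≡⟨ combine-remQuot {2} 2 j′ ⟩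
    j′                                    ∎
    where open ≡-Reasoning

  OnNode : Fin 2 → Fin n ⊎ Fin 4 → Set
  OnNode t (inj₁ _) = ⊤
  OnNode t (inj₂ j) = node j ≡ t

  InClass : Fin 2 → Fin 3 → Fin n ⊎ Fin 4 → Set
  InClass t k (inj₁ i) = c i ≡ k
  InClass t k (inj₂ j) = node j ≡ t × inject₁ (slot j) ≡ k

  onNode? : ∀ t x → Dec (OnNode t x)
  onNode? t (inj₁ _) = yes tt
  onNode? t (inj₂ j) = node j ≟ᶠ t

  inClass? : ∀ t k x → Dec (InClass t k x)
  inClass? t k (inj₁ i) = c i ≟ᶠ k
  inClass? t k (inj₂ j) = (node j ≟ᶠ t) ×-dec (inject₁ (slot j) ≟ᶠ k)

  bag₂ : Fin 2 → Subset (n + 4)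
  bag₂ t = ⟦ onNode? t ∘ splitAt n ⟧

  class : Fin 2 → Fin 3 → Subset (n + 4)
  class t k = ⟦ inClass? t k ∘ splitAt n ⟧

  ∈bag₂ : ∀ {t u} → u ∈ bag₂ t ⇔ OnNode t (splitAt n u)
  ∈bag₂ {t} = ∈⟦⟧⇔ (onNode? t ∘ splitAt n)

  ∈class : ∀ {t k u} → u ∈ class t k ⇔ InClass t k (splitAt n u)
  ∈class {t} {k} = ∈⟦⟧⇔ (inClass? t k ∘ splitAt n)

  on-some-node : ∀ x → ∃[ t ] OnNode t x
  on-some-node (inj₁ _) = zero , tt
  on-some-node (inj₂ j) = node j , refl

  on-node⇔in-class : ∀ t x → OnNode t x ⇔ (∃[ k ] InClass t k x)
  on-node⇔in-class t (inj₁ i) = mk⇔ (λ _ → c i , refl) (λ _ → tt)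
  on-node⇔in-class t (inj₂ j) = mk⇔ (λ on-t → inject₁ (slot j) , on-t , refl) (λ (_ , on-t , _) → on-t)

  edge-on-node : ∀ u v → Adj H u v → ∃[ t ] (OnNode t (splitAt n u) × OnNode t (splitAt n v))
  edge-on-node u v uv with splitAt n u | splitAt n v
  ... | inj₁ _ | inj₁ _ = zero , tt , tt
  ... | inj₁ _ | inj₂ j = node j , tt , refl
  ... | inj₂ j | inj₁ _ = node j , refl , tt
  edge-on-node u v () | inj₂ _ | inj₂ _

  class-clique : ∀ {t k u v} → InClass t k (splitAt n u) → InClass t k (splitAt n v) → u ≢ v → Adj H u v
  class-clique {u = u} {v} u∈ v∈ u≢v with splitAt n u in eu | splitAt n v in ev
  ... | inj₁ i | inj₁ i′ = complement-nonadj G i≢i′ (λ ii′ → proper i i′ ii′ (trans u∈ (sym v∈)))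
    where
      i≢i′ : i ≢ i′
      i≢i′ refl = u≢v (trans (sym (splitAt⁻¹-↑ˡ eu)) (splitAt⁻¹-↑ˡ ev))
  ... | inj₁ _ | inj₂ _ = refl
  ... | inj₂ _ | inj₁ _ = refl
  ... | inj₂ j | inj₂ j′ = ⊥-elim (u≢v (trans (sym (splitAt⁻¹-↑ʳ eu)) (trans (cong (n ↑ʳ_) j≡j′) (splitAt⁻¹-↑ʳ ev))))
    where
      j≡j′ : j ≡ j′
      j≡j′ = node-slot-injective (trans (proj₁ u∈) (sym (proj₁ v∈)))
                                 (inject₁-injective (trans (proj₂ u∈) (sym (proj₂ v∈))))

  decomposition : TreeDecomposition H
  decomposition = record
    { m = 2
    ; tree = K₂
    ; isTree = K₂-isTree
    ; bag = bag₂
    ; covers = λ u → let t , on-t = on-some-node (splitAt n u) in t , ∈bag₂ .from on-t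
    ; edges = λ u v uv → let t , u-on-t , v-on-t = edge-on-node u v uv in t , ∈bag₂ .from u-on-t , ∈bag₂ .from v-on-t
    ; subtree = λ v s t → K₂-walk s t
    }

  bag₂-covered : ∀ t u → u ∈ bag₂ t ⇔ (∃[ k ] u ∈ class t k)
  bag₂-covered t u = mk⇔
    (λ u∈t → let k , u∈k = on-node⇔in-class t _ .to (∈bag₂ .to u∈t) in k , ∈class .from u∈k)
    (λ (k , u∈k) → ∈bag₂ .from (on-node⇔in-class t _ .from (k , ∈class .to u∈k)))

  tcl≤3 : TclAtMost H 3
  tcl≤3 = decomposition , λ t →
    vcc-tabulate H (class t) (λ k u v u∈ v∈ → class-clique (∈class .to u∈) (∈class .to v∈)) (bag₂-covered t)

module FromDecomposition {n} (G : Graph n) where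

  private H = addUniversalIndependent 4 (complement G)

  colourable : TclAtMost H 3 → Colourable 3 G
  colourable (D , narrow) with side-within-bag D (_↑ˡ 4) (n ↑ʳ_) (universal-old-new 4 (complement G)) t₀
    where t₀ = proj₁ (covers D (n ↑ʳ zero))
  ... | inj₁ (t , old∈t) with cover-labelling H (_↑ˡ 4) old∈t (narrow t)
  ...   | κ , κ-clique = κ , proper
    where
      proper : ∀ u v → Adj G u v → κ u ≢ κ v
      proper u v uv κu≡κv
        with trans (sym (complement-adj G uv))
                   (trans (sym (universal-old-old 4 (complement G) u v))
                          (κ-clique u v κu≡κv (λ e → Adj⇒≢ G uv (↑ˡ-injective 4 u v e))))
      ... | ()
  colourable (D , narrow) | inj₂ (t , new∈t) with cover-labelling H (n ↑ʳ_) new∈t (narrow t)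
  ...   | κ , κ-clique = ⊥-elim (<⇒notInjective (s≤s (s≤s (s≤s (s≤s z≤n)))) κ-injective)
    where
      κ-injective : Injective _≡_ _≡_ κ
      κ-injective {j} {j′} κj≡κj′ with j ≟ᶠ j′
      ... | yes j≡j′ = j≡j′
      ... | no j≢j′ = ⊥-elim (universal-new-new 4 (complement G) j j′
                               (κ-clique j j′ κj≡κj′ (λ e → j≢j′ (↑ʳ-injective n j j′ e))))

lemma4 : ∀ {n : ℕ} (G : Graph n) →
    Colourable 3 G ⇔ TclAtMost (addUniversalIndependent 4 (complement G)) 3
lemma4 G = mk⇔ (λ (c , proper) → FromColouring.tcl≤3 G c proper) (FromDecomposition.colourable G)
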